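{- Let $s\ge1$, $t\ge 2$, $G\in\mathcal{G}_{s,t}$ with root $r$, and let $C$ be a non-trivial configuration with $k$ pebble-free vertices in $S$. If $k$ is even and $C_T\ge k+3$, then Mover has a winning strategy.
   Context: A configuration $C$ on a graph $G$ is a function $C:V(G)\to\mathbb{Z}_{\ge 0}$. A pebbling move removes two pebbles from a vertex and places one pebble on an adjacent vertex. The Two-Player Pebbling Game on $G$ with root $r$ and starting configuration $C$ is played by Mover and Defender in rounds: in each round Mover makes a pebbling move and then Defender makes a pebbling move; each player must take their turn. If Mover pebbles from $u$ to $v$, Defender may not pebble from $v$ to $u$ in the same round. Mover wins if at any time the root has at least one pebble; Defender wins if the root has no pebble and there are no more pebbling moves. A winning strategy is a rule choosing a player's moves as a function of the current position which guarantees that player wins. For integers $s,t\ge1$, $\mathcal{G}_{s,t}$ is the class of all graphs $(K_1\cup \overline{K_t})\vee H$, where $H$ is any graph on $s$ vertices, $\overline{K_t}$ is the edgeless graph on $t$ vertices, $\cup$ is disjoint union and $\vee$ is the join. The root $r$ is the vertex of $K_1$; $S=V(H)$, $T=V(\overline{K_t})$. A configuration is non-trivial if each vertex of $S$ has 0 or 1 pebbles and the root has no pebbles. A vertex is pebble-free if it has no pebbles. $k$ is the number of pebble-free vertices of $S$, and $C_T=\sum_{v\in T}\lfloor C(v)/2\rfloor$. -}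

module Defs where

open import Data.Nat using (ℕ; zero; suc; _∸_; _≤_; _/_)
open import Data.Bool using (Bool; true; false; if_then_else_)
open import Data.Fin using (Fin)
import Data.Fin as F
open import Data.List using (List; length; filter; allFin; map)
open import Data.Nat.ListAction using (sum)
open import Data.Unit using (⊤)
open import Data.Product using (Σ; ∃; _×_; _,_)
open import Data.Empty using (⊥)
open import Relation.Nullary using (¬_; Dec; yes; no)
open import Relation.Nullary.Decidable using (⌊_⌋; map′)
open import Relation.Binary.PropositionalEquality using (_≡_; refl; cong)
import Data.Nat as N

record SimpleGraph (s : ℕ) : Set where
  field
    adj    : Fin s → Fin s → Bool
    sym    : ∀ i j → adj i j ≡ adj j i
    irrefl : ∀ i → adj i i ≡ false
open SimpleGraph public

-- Vertices of G = (K_1 ∪ \bar K_t) ∨ H : the root, the s vertices of S = V(H),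
-- and the t vertices of T.
data Vtx (s t : ℕ) : Set where
  root : Vtx s t
  sv   : Fin s → Vtx s t
  tv   : Fin t → Vtx s t

Adj : ∀ {s t} → SimpleGraph s → Vtx s t → Vtx s t → Set
Adj H root   (sv _) = ⊤
Adj H (tv _) (sv _) = ⊤
Adj H (sv _) root   = ⊤
Adj H (sv _) (tv _) = ⊤
Adj H (sv i) (sv j) = adj H i j ≡ true
Adj H _      _      = ⊥

_≟V_ : ∀ {s t} → (u v : Vtx s t) → Dec (u ≡ v)
root ≟V root = yes refl
root ≟V sv _ = no λ ()
root ≟V tv _ = no λ ()
sv _ ≟V root = no λ ()
sv i ≟V sv j with i F.≟ j
... | yes refl = yes refl
... | no ne = no λ { refl → ne refl }
sv _ ≟V tv _ = no λ ()
tv _ ≟V root = no λ ()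
tv _ ≟V sv _ = no λ ()
tv i ≟V tv j with i F.≟ j
... | yes refl = yes refl
... | no ne = no λ { refl → ne refl }

Config : ℕ → ℕ → Set
Config s t = Vtx s t → ℕ

move : ∀ {s t} → Config s t → Vtx s t → Vtx s t → Config s t
move C u v w =
  if ⌊ w ≟V u ⌋ then C w ∸ 2
  else if ⌊ w ≟V v ⌋ then suc (C w)
  else C w

Legal : ∀ {s t} → SimpleGraph s → Config s t → Vtx s t → Vtx s t → Set
Legal H C u v = Adj H u v × 2 ≤ C u

-- Winning positions for Mover in the two-player pebbling game (the game is
-- finite since every move decreases the total number of pebbles, so Mover
-- has a winning strategy iff the position is in the inductively defined set).
--   AfterMover H C u v : Mover has just pebbled u → v, reaching C; Defender's turn
--                        (Defender may not pebble v → u).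
mutual
  data MoverWins {s t} (H : SimpleGraph s) (C : Config s t) : Set where
    win-now  : 1 ≤ C root → MoverWins H C
    mover-go : (u v : Vtx s t) → Legal H C u v →
               AfterMover H (move C u v) u v → MoverWins H C

  data AfterMover {s t} (H : SimpleGraph s) (C : Config s t) (u v : Vtx s t) : Set where
    win-root  : 1 ≤ C root → AfterMover H C u v
    all-reply : (Σ (Vtx s t) λ x → Σ (Vtx s t) λ y →
                   Legal H C x y × ¬ (x ≡ v × y ≡ u)) →
                ((x y : Vtx s t) → Legal H C x y → ¬ (x ≡ v × y ≡ u) →
                   MoverWins H (move C x y)) →
                AfterMover H C u v

NonTrivial : ∀ {s t} → Config s t → Set
NonTrivial {s} C = C root ≡ 0 × ((i : Fin s) → C (sv i) ≤ 1)

pebbleFreeS : ∀ {s t} → Config s t → ℕ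
pebbleFreeS {s} C = length (filter (λ i → C (sv i) N.≟ 0) (allFin s))

CT : ∀ {s t} → Config s t → ℕ
CT {t = t} C = sum (map (λ j → C (tv j) / 2) (allFin t))

module Submission where

open import Defs hiding (sym)
open import Data.Nat using (ℕ; zero; suc; _+_; _*_; _∸_; _/_; _≤_; s≤s; z≤n; _≟_)
open import Data.Nat.Properties
  using (≤-trans; ≤-refl; ≤-antisym; ≤-pred; +-mono-≤; m≤m+n; n≤1+n; n≤0⇒n≡0; m<n⇒n≢0;
         +-cancelˡ-≡; +-cancelˡ-≤; +-0-commutativeMonoid)
open import Data.Nat.DivMod using (/-monoˡ-≤; m/n≡1+[m∸n]/n; m/n≢0⇒n≤m)
open import Data.Nat.Divisibility using (_∣_; divides)
open import Data.Nat.ListAction using (sum)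
open import Algebra.Properties.CommutativeMonoid.Sum +-0-commutativeMonoid
  using (sum-remove; sum-cong-≗) renaming (sum to ∑)
open import Data.Fin using (Fin; punchIn) renaming (zero to fzero; suc to fsuc)
import Data.Fin as Fin
open import Data.Fin.Properties using (punchInᵢ≢i)
open import Data.List using (List; []; _∷_; length; filter; map; tabulate)
open import Data.List.Properties using (map-tabulate)
open import Data.Unit using (tt)
open import Data.Product using (Σ; ∃; _×_; _,_)
open import Data.Sum using (_⊎_; inj₁; inj₂)
open import Data.Empty using (⊥-elim)
open import Function using (_∘_; id)
open import Relation.Nullary using (¬_; Dec; yes; no; contradiction)
open import Relation.Nullary.Decidable using (decidable-stable)
open import Relation.Binary.PropositionalEquality
  using (_≡_; _≢_; refl; sym; trans; cong; cong₂; subst; subst₂; module ≡-Reasoning)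

-- Mover's strategy is to keep filling pebble-free vertices of S from T.  In a
-- non-trivial configuration every legal move either puts a pebble onto the root or
-- onto an occupied vertex of S (after which Mover reaches the root at once), or
-- "fills": it sends two pebbles of a T-vertex to a pebble-free vertex of S.  A fill
-- lowers k by one and C_T by one, so a round of two fills keeps the parity of k and
-- the surplus C_T - k.
--   * k odd, C_T ≥ k + 1: Mover fills, Defender can only fill, and when S is full it
--     is Defender who must double up a vertex of S (oddCase, by induction on k).
--   * k even, C_T ≥ k + 3: rounds of two fills reduce to k = 0; then Mover doubles a
--     vertex v of S and Defender's only non-losing answer empties v into T, which is
--     the odd case with k = 1 (evenCase).

isZero : ℕ → ℕ
isZero zero    = 1
isZero (suc _) = 0

isZero≡0⇒positive : ∀ a → isZero a ≡ 0 → 1 ≤ a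
isZero≡0⇒positive (suc _) _ = s≤s z≤n

isZero-positive⇒≡0 : ∀ a → 1 ≤ isZero a → a ≡ 0
isZero-positive⇒≡0 zero _ = refl

∑-bound : ∀ {n} (f : Fin n → ℕ) i → f i ≤ ∑ f
∑-bound {suc n} f i = subst (f i ≤_) (sym (sum-remove {i = i} f)) (m≤m+n (f i) _)

∑-zero : ∀ {n} (f : Fin n → ℕ) → ∑ f ≡ 0 → ∀ i → f i ≡ 0
∑-zero f sum≡0 i = n≤0⇒n≡0 (subst (f i ≤_) sum≡0 (∑-bound f i))

∑-positive : ∀ {n} (f : Fin n → ℕ) → 1 ≤ ∑ f → ∃ λ i → 1 ≤ f i
∑-positive {suc n} f pos with f fzero in eq
... | suc _ = fzero , subst (1 ≤_) (sym eq) (s≤s z≤n)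
... | zero  = let (i , fi) = ∑-positive (f ∘ fsuc) pos in fsuc i , fi

∑-mono : ∀ {n} (f g : Fin n → ℕ) → (∀ i → f i ≤ g i) → ∑ f ≤ ∑ g
∑-mono {zero}  f g f≤g = z≤n
∑-mono {suc n} f g f≤g = +-mono-≤ (f≤g fzero) (∑-mono (f ∘ fsuc) (g ∘ fsuc) (f≤g ∘ fsuc))

∑-pointDecrease : ∀ {n} (f g : Fin n → ℕ) w → (∀ i → i ≢ w → f i ≡ g i) →
  f w ≡ suc (g w) → ∑ f ≡ suc (∑ g)
∑-pointDecrease {suc n} f g w agree fw = begin
  ∑ f                            ≡⟨ sum-remove {i = w} f ⟩
  f w + ∑ (f ∘ punchIn w)        ≡⟨ cong₂ _+_ fw (sum-cong-≗ (λ i → agree (punchIn w i) (punchInᵢ≢i w i))) ⟩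
  suc (g w + ∑ (g ∘ punchIn w))  ≡⟨ cong suc (sym (sum-remove {i = w} g)) ⟩
  suc (∑ g)                      ∎
  where open ≡-Reasoning

count-as-sum : ∀ {A : Set} (f : A → ℕ) (xs : List A) →
  length (filter (λ a → f a ≟ 0) xs) ≡ sum (map (isZero ∘ f) xs)
count-as-sum f []       = refl
count-as-sum f (x ∷ xs) with f x
... | zero  = cong suc (count-as-sum f xs)
... | suc _ = count-as-sum f xs

sum-tabulate : ∀ {n} (f : Fin n → ℕ) → sum (tabulate f) ≡ ∑ f
sum-tabulate {zero}  f = refl
sum-tabulate {suc n} f = cong (f fzero +_) (sum-tabulate (f ∘ fsuc))

free : ∀ {s t} → Config s t → ℕ
free C = ∑ (λ i → isZero (C (sv i)))

reserve : ∀ {s t} → Config s t → ℕ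
reserve C = ∑ (λ j → C (tv j) / 2)

pebbleFreeS≡free : ∀ {s t} (C : Config s t) → pebbleFreeS C ≡ free C
pebbleFreeS≡free C = begin
  pebbleFreeS C                                       ≡⟨ count-as-sum (C ∘ sv) (tabulate id) ⟩
  sum (map (λ i → isZero (C (sv i))) (tabulate id))  ≡⟨ cong sum (map-tabulate id (isZero ∘ C ∘ sv)) ⟩
  sum (tabulate (λ i → isZero (C (sv i))))            ≡⟨ sum-tabulate (isZero ∘ C ∘ sv) ⟩
  free C                                              ∎
  where open ≡-Reasoning

CT≡reserve : ∀ {s t} (C : Config s t) → CT C ≡ reserve C
CT≡reserve {t = t} C = trans (cong sum (map-tabulate id half)) (sum-tabulate half)
  where
  half : Fin t → ℕ
  half j = C (tv j) / 2

-- Small facts about vertices.  The hypotheses s ≥ 1 and t ≥ 2 of the theorem are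
-- used through someVertex and anotherVertex.

sv-injective : ∀ {s t} {i j : Fin s} → sv {t = t} i ≡ sv j → i ≡ j
sv-injective refl = refl

tv-injective : ∀ {s t} {i j : Fin t} → tv {s = s} i ≡ tv j → i ≡ j
tv-injective refl = refl

someVertex : ∀ {n} → 1 ≤ n → Fin n
someVertex {suc _} _ = fzero

anotherVertex : ∀ {n} → 2 ≤ n → (j : Fin n) → ∃ λ z → z ≢ j
anotherVertex (s≤s (s≤s _)) fzero    = fsuc fzero , λ ()
anotherVertex (s≤s (s≤s _)) (fsuc _) = fzero , λ ()

pointwise : ∀ {n} (P : Fin n → Set) w → P w → (∀ i → i ≢ w → P i) → ∀ i → P i
pointwise P w atW offW i with i Fin.≟ w
... | yes refl = atW
... | no i≢w   = offW i i≢w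

cannotMove : ∀ {a} → a ≤ 1 → ¬ (2 ≤ a)
cannotMove a≤1 2≤a with ≤-trans 2≤a a≤1
... | s≤s ()

moveSource : ∀ {s t} (C : Config s t) u v → move C u v u ≡ C u ∸ 2
moveSource C u v with u ≟V u
... | yes _   = refl
... | no u≢u = ⊥-elim (u≢u refl)

moveTarget : ∀ {s t} (C : Config s t) u v → u ≢ v → move C u v v ≡ suc (C v)
moveTarget C u v u≢v with v ≟V u
... | yes v≡u = ⊥-elim (u≢v (sym v≡u))
... | no _ with v ≟V v
...   | yes _   = refl
...   | no v≢v = ⊥-elim (v≢v refl)

moveElsewhere : ∀ {s t} (C : Config s t) u v w → w ≢ u → w ≢ v → move C u v w ≡ C w
moveElsewhere C u v w w≢u w≢v with w ≟V u
... | yes w≡u = ⊥-elim (w≢u w≡u)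
... | no _ with w ≟V v
...   | yes w≡v = ⊥-elim (w≢v w≡v)
...   | no _    = refl

moveMonotone : ∀ {s t} (C : Config s t) u v w → w ≢ u → C w ≤ move C u v w
moveMonotone C u v w w≢u = byTarget (w ≟V v)
  where
  byTarget : Dec (w ≡ v) → C w ≤ move C u v w
  byTarget (yes w≡v) = subst (λ x → C x ≤ move C u v x) (sym w≡v)
    (subst (C v ≤_) (sym (moveTarget C u v (λ u≡v → w≢u (trans w≡v (sym u≡v))))) (n≤1+n (C v)))
  byTarget (no w≢v)  = subst (C w ≤_) (sym (moveElsewhere C u v w w≢u w≢v)) ≤-refl

fill-nonTrivial : ∀ {s t} (C : Config s t) j w → NonTrivial C → C (sv w) ≡ 0 →
  NonTrivial (move C (tv j) (sv w))
fill-nonTrivial C j w (rootEmpty , atMostOne) empty =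
  trans (moveElsewhere C (tv j) (sv w) root (λ ()) (λ ())) rootEmpty ,
  pointwise (λ i → move C (tv j) (sv w) (sv i) ≤ 1) w
    (subst (_≤ 1) (sym (trans (moveTarget C (tv j) (sv w) (λ ())) (cong suc empty))) ≤-refl)
    (λ i i≢w → subst (_≤ 1) (sym (moveElsewhere C (tv j) (sv w) (sv i) (λ ()) (i≢w ∘ sv-injective))) (atMostOne i))

fill-free : ∀ {s t} (C : Config s t) j w → C (sv w) ≡ 0 →
  free C ≡ suc (free (move C (tv j) (sv w)))
fill-free C j w empty =
  ∑-pointDecrease (isZero ∘ C ∘ sv) (isZero ∘ move C (tv j) (sv w) ∘ sv) w
  (λ i i≢w → cong isZero (sym (moveElsewhere C (tv j) (sv w) (sv i) (λ ()) (i≢w ∘ sv-injective))))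
  (trans (cong isZero empty) (cong (suc ∘ isZero) (sym (moveTarget C (tv j) (sv w) (λ ())))))

reserve-spend : ∀ {s t} (C : Config s t) j w → 2 ≤ C (tv j) →
  reserve C ≡ suc (reserve (move C (tv j) (sv w)))
reserve-spend C j w two =
  ∑-pointDecrease (λ i → C (tv i) / 2) (λ i → move C (tv j) (sv w) (tv i) / 2) j
  (λ i i≢j → cong (_/ 2) (sym (moveElsewhere C (tv j) (sv w) (tv i) (i≢j ∘ tv-injective) (λ ()))))
  (trans (m/n≡1+[m∸n]/n two) (cong (λ a → suc (a / 2)) (sym (moveSource C (tv j) (sv w)))))

emptyVertex : ∀ {s t} (C : Config s t) → 1 ≤ free C → ∃ λ w → C (sv w) ≡ 0
emptyVertex C pos =
  let (w , one) = ∑-positive _ pos in w , isZero-positive⇒≡0 (C (sv w)) one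

reserveSource : ∀ {s t} (C : Config s t) → 1 ≤ reserve C → ∃ λ j → 2 ≤ C (tv j)
reserveSource C pos =
  let (j , half) = ∑-positive _ pos in j , m/n≢0⇒n≤m (m<n⇒n≢0 half)

occupied : ∀ {s t} (C : Config s t) → free C ≡ 0 → ∀ i → 1 ≤ C (sv i)
occupied C none i = isZero≡0⇒positive (C (sv i)) (∑-zero _ none i)

module Game {s t : ℕ} (H : SimpleGraph s) where

  adj-irrefl : ∀ {x y : Vtx s t} → Adj H x y → x ≢ y
  adj-irrefl {sv i} a refl with trans (sym a) (irrefl H i)
  ... | ()

  doubledWins : ∀ (C : Config s t) w → 2 ≤ C (sv w) → MoverWins H C
  doubledWins C w two = mover-go (sv w) root (tt , two) (win-root (s≤s z≤n))

  rootLandingWins : ∀ (C : Config s t) x → Adj H x root → MoverWins H (move C x root)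
  rootLandingWins C x a =
    win-now (subst (1 ≤_) (sym (moveTarget C x root (adj-irrefl a))) (s≤s z≤n))

  occupiedLandingWins : ∀ (C : Config s t) x w → Adj H x (sv w) → 1 ≤ C (sv w) →
    MoverWins H (move C x (sv w))
  occupiedLandingWins C x w a one =
    doubledWins _ w (subst (2 ≤_) (sym (moveTarget C x (sv w) (adj-irrefl a))) (s≤s one))

  data Fill (C : Config s t) : Vtx s t → Vtx s t → Set where
    fill : ∀ j w → 2 ≤ C (tv j) → C (sv w) ≡ 0 → Fill C (tv j) (sv w)

  -- In a non-trivial configuration, a legal move either hands Mover the win or is a
  -- fill: the root and S hold too few pebbles to move from, so it starts in T.
  winsOrFill : ∀ (C : Config s t) {x y} → NonTrivial C → Legal H C x y →
    MoverWins H (move C x y) ⊎ Fill C x y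
  winsOrFill C {x} {root} _ (a , _) = inj₁ (rootLandingWins C x a)
  winsOrFill C {root} (rootEmpty , _) (_ , two) =
    ⊥-elim (cannotMove (subst (_≤ 1) (sym rootEmpty) z≤n) two)
  winsOrFill C {sv i} (_ , atMostOne) (_ , two) = ⊥-elim (cannotMove (atMostOne i) two)
  winsOrFill C {tv j} {sv w} _ (a , two) with C (sv w) in eq
  ... | zero  = inj₂ (fill j w two eq)
  ... | suc _ = inj₁ (occupiedLandingWins C (tv j) w a (subst (1 ≤_) (sym eq) (s≤s z≤n)))
  winsOrFill C {tv _} {tv _} _ (() , _)

  -- With k ≥ 1 Mover fills; with C_T ≥ 2 Defender then has a
  -- fill available, and any other answer loses.
  fillRound : ∀ (C : Config s t) → NonTrivial C → 1 ≤ free C → 2 ≤ reserve C →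
    (∀ C″ → NonTrivial C″ → free C ≡ 2 + free C″ → reserve C ≡ 2 + reserve C″ → MoverWins H C″) →
    MoverWins H C
  fillRound C nt hasEmpty enough next
    with emptyVertex C hasEmpty | reserveSource C (≤-trans (s≤s z≤n) enough)
  ... | w , empty | j , two = mover-go (tv j) (sv w) (tt , two) (all-reply answer respond)
    where
    C′ : Config s t
    C′ = move C (tv j) (sv w)
    nt′ : NonTrivial C′
    nt′ = fill-nonTrivial C j w nt empty
    reserve′ : reserve C ≡ suc (reserve C′)
    reserve′ = reserve-spend C j w two
    answer : Σ (Vtx s t) λ x → Σ (Vtx s t) λ y → Legal H C′ x y × ¬ (x ≡ sv w × y ≡ tv j)
    answer = let (j′ , two′) = reserveSource C′ (≤-pred (subst (2 ≤_) reserve′ enough))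
             in tv j′ , sv w , (tt , two′) , λ { (() , _) }
    respond : ∀ x y → Legal H C′ x y → ¬ (x ≡ sv w × y ≡ tv j) → MoverWins H (move C′ x y)
    respond x y legal _ with winsOrFill C′ nt′ legal
    ... | inj₁ wins = wins
    ... | inj₂ (fill j″ w″ two″ empty″) =
      next _ (fill-nonTrivial C′ j″ w″ nt′ empty″)
        (trans (fill-free C j w empty) (cong suc (fill-free C′ j″ w″ empty″)))
        (trans reserve′ (cong suc (reserve-spend C′ j″ w″ two″)))

  -- k odd and C_T ≥ k + 1: by induction on k, using rounds of two fills.  At k = 1
  -- Mover fills the last vertex and Defender cannot fill back.
  oddCase : ∀ q (C : Config s t) → NonTrivial C → free C ≡ suc (q * 2) → q * 2 + 2 ≤ reserve C →
    MoverWins H C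
  oddCase zero C nt k r =
    fillRound C nt (subst (1 ≤_) (sym k) (s≤s z≤n)) r
      λ _ _ k″ _ → contradiction (trans (sym k) k″) λ ()
  oddCase (suc q) C nt k r =
    fillRound C nt (subst (1 ≤_) (sym k) (s≤s z≤n)) (≤-trans (m≤m+n 2 _) r)
      λ C″ nt″ k″ r″ → oddCase q C″ nt″ (+-cancelˡ-≡ 2 _ _ (trans (sym k″) k))
                                        (+-cancelˡ-≤ 2 _ _ (subst (_ ≤_) r″ r))

  -- After Mover doubles up the vertex v of a full S and Defender empties v into T,
  -- v is the only pebble-free vertex and C_T has dropped by at most one: this is the
  -- odd case with k = 1.
  afterRetreat : ∀ (C : Config s t) j v z → NonTrivial C → free C ≡ 0 → C (sv v) ≡ 1 →
    2 ≤ C (tv j) → 3 ≤ reserve C → MoverWins H (move (move C (tv j) (sv v)) (sv v) (tv z))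
  afterRetreat C j v z (rootEmpty , atMostOne) none one two r =
    oddCase zero C₂ (rootEmpty₂ , atMostOne₂) free₂ reserve₂
    where
    C₁ C₂ : Config s t
    C₁ = move C (tv j) (sv v)
    C₂ = move C₁ (sv v) (tv z)
    unchanged : ∀ i → i ≢ v → C₂ (sv i) ≡ C (sv i)
    unchanged i i≢v = trans (moveElsewhere C₁ (sv v) (tv z) (sv i) (i≢v ∘ sv-injective) (λ ()))
                            (moveElsewhere C (tv j) (sv v) (sv i) (λ ()) (i≢v ∘ sv-injective))
    emptied : C₂ (sv v) ≡ 0
    emptied = trans (moveSource C₁ (sv v) (tv z))
                    (cong (_∸ 2) (trans (moveTarget C (tv j) (sv v) (λ ())) (cong suc one)))
    rootEmpty₂ : C₂ root ≡ 0
    rootEmpty₂ = trans (moveElsewhere C₁ (sv v) (tv z) root (λ ()) (λ ()))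
                       (trans (moveElsewhere C (tv j) (sv v) root (λ ()) (λ ())) rootEmpty)
    atMostOne₂ : ∀ i → C₂ (sv i) ≤ 1
    atMostOne₂ = pointwise (λ i → C₂ (sv i) ≤ 1) v (subst (_≤ 1) (sym emptied) z≤n)
      (λ i i≢v → subst (_≤ 1) (sym (unchanged i i≢v)) (atMostOne i))
    free₂ : free C₂ ≡ 1
    free₂ = trans (∑-pointDecrease (isZero ∘ C₂ ∘ sv) (isZero ∘ C ∘ sv) v
                    (λ i i≢v → cong isZero (unchanged i i≢v))
                    (trans (cong isZero emptied) (cong (suc ∘ isZero) (sym one))))
                  (cong suc none)
    reserve₂ : 2 ≤ reserve C₂
    reserve₂ = ≤-trans (≤-pred (subst (3 ≤_) (reserve-spend C j v two) r))
                       (∑-mono (λ k → C₁ (tv k) / 2) (λ k → C₂ (tv k) / 2)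
                         (λ k → /-monoˡ-≤ 2 (moveMonotone C₁ (sv v) (tv z) (tv k) (λ ()))))

  -- Defender's only answer
  -- that does not lose at once moves the two pebbles of v into T (t ≥ 2 makes one
  -- available that is not the reverse of Mover's move).
  fullSCase : 1 ≤ s → 2 ≤ t → ∀ (C : Config s t) → NonTrivial C → free C ≡ 0 → 3 ≤ reserve C →
    MoverWins H C
  fullSCase s≥1 t≥2 C nt@(_ , atMostOne) none r with reserveSource C (≤-trans (s≤s z≤n) r)
  ... | j , two = mover-go (tv j) (sv v) (tt , two) (all-reply answer respond)
    where
    v : Fin s
    v = someVertex s≥1
    C₁ : Config s t
    C₁ = move C (tv j) (sv v)
    one : ∀ i → C (sv i) ≡ 1
    one i = ≤-antisym (atMostOne i) (occupied C none i)
    answer : Σ (Vtx s t) λ x → Σ (Vtx s t) λ y → Legal H C₁ x y × ¬ (x ≡ sv v × y ≡ tv j)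
    answer = let (z , z≢j) = anotherVertex t≥2 j
             in sv v , tv z ,
                (tt , subst (2 ≤_) (sym (trans (moveTarget C (tv j) (sv v) (λ ())) (cong suc (one v)))) ≤-refl) ,
                λ { (_ , tz≡tj) → z≢j (tv-injective tz≡tj) }
    -- Every other vertex of S still holds a single pebble.
    onlyVMovable : ∀ i → 2 ≤ C₁ (sv i) → i ≡ v
    onlyVMovable i two′ = decidable-stable (i Fin.≟ v) λ i≢v →
      cannotMove (subst (_≤ 1) (sym (moveElsewhere C (tv j) (sv v) (sv i) (λ ()) (i≢v ∘ sv-injective)))
                   (atMostOne i)) two′
    respond : ∀ x y → Legal H C₁ x y → ¬ (x ≡ sv v × y ≡ tv j) → MoverWins H (move C₁ x y)
    respond x root (a , _) _ = rootLandingWins C₁ x a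
    respond x (sv w) (a , _) _ =
      occupiedLandingWins C₁ x w a (≤-trans (occupied C none w) (moveMonotone C (tv j) (sv v) (sv w) (λ ())))
    respond (sv i) (tv z) (_ , two′) _ =
      subst (λ i → MoverWins H (move C₁ (sv i) (tv z))) (sym (onlyVMovable i two′))
        (afterRetreat C j v z nt none (one v) two r)
    respond root   (tv _) (() , _) _
    respond (tv _) (tv _) (() , _) _

  evenCase : 1 ≤ s → 2 ≤ t → ∀ q (C : Config s t) → NonTrivial C → free C ≡ q * 2 →
    q * 2 + 3 ≤ reserve C → MoverWins H C
  evenCase s≥1 t≥2 zero C nt k r = fullSCase s≥1 t≥2 C nt k r
  evenCase s≥1 t≥2 (suc q) C nt k r =
    fillRound C nt (subst (1 ≤_) (sym k) (s≤s z≤n)) (≤-trans (m≤m+n 2 _) r)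
      λ C″ nt″ k″ r″ → evenCase s≥1 t≥2 q C″ nt″ (+-cancelˡ-≡ 2 _ _ (trans (sym k″) k))
                                                  (+-cancelˡ-≤ 2 _ _ (subst (_ ≤_) r″ r))

lemma3p6 : (s t : ℕ) → 1 ≤ s → 2 ≤ t → (H : SimpleGraph s) → (C : Config s t) →
    NonTrivial C → 2 ∣ pebbleFreeS C → pebbleFreeS C + 3 ≤ CT C →
    MoverWins H C
lemma3p6 s t s≥1 t≥2 H C nt (divides q k≡q*2) bound =
  Game.evenCase H s≥1 t≥2 q C nt (trans (sym (pebbleFreeS≡free C)) k≡q*2)
    (subst₂ _≤_ (cong (_+ 3) k≡q*2) (CT≡reserve C) bound)
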